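{- Let $b\ge1$ be an integer, let $T$ be a tree, and let $G$ be the graph obtained from $T$ by adding a new vertex $w$ adjacent to all vertices of $T$. If $\mathrm{bw}(T)\le b$, then $G$ admits an outer $(5b-5)$-planar drawing.
   Context: For a linear order $\sigma\colon V(T)\to[n]$ (bijection), the stretch of an edge $\{u,v\}$ is $|\sigma(u)-\sigma(v)|$; the bandwidth of $\sigma$ is the maximum stretch of an edge, and $\mathrm{bw}(T)$ is the minimum bandwidth over all linear orders of $V(T)$. A circular drawing is a cyclic order of the vertices; two edges with four distinct endpoints cross if their endpoints interleave in the cyclic order; a circular drawing is outer $k$-planar if every edge is crossed by at most $k$ edges. -}

module Defs where

open import Data.Nat using (ℕ; zero; suc; _≤_; _<_; _*_; _∸_; ∣_-_∣; _<ᵇ_)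
open import Data.Fin using (Fin; toℕ) renaming (zero to fzero; suc to fsuc)
open import Data.Fin.Properties using (_≟_)
open import Data.Bool using (Bool; true; false; _∧_; _∨_; not; _xor_; if_then_else_)
open import Data.List using (List; []; _∷_; length; filter; allFin; concatMap; map)
open import Data.List.Relation.Unary.Unique.Propositional using (Unique)
open import Data.List.Relation.Unary.Linked using (Linked)
open import Data.Product using (Σ; _×_; _,_; ∃-syntax)
open import Relation.Binary.PropositionalEquality using (_≡_)
open import Relation.Nullary using (¬_)
open import Relation.Nullary.Decidable using (⌊_⌋)
open import Function.Definitions using (Bijective)

record Graph (n : ℕ) : Set where
  field
    adj   : Fin n → Fin n → Bool
    sym   : ∀ u v → adj u v ≡ adj v u
    irrfl : ∀ u → adj u u ≡ false
open Graph public

Adj : ∀ {n} → Graph n → Fin n → Fin n → Set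
Adj G u v = adj G u v ≡ true

data Walk {n} (G : Graph n) : Fin n → Fin n → Set where
  here : ∀ u → Walk G u u
  step : ∀ {u v w} → Adj G u v → Walk G v w → Walk G u w

Connected : ∀ {n} → Graph n → Set
Connected G = ∀ u v → Walk G u v

last : ∀ {A : Set} → A → List A → A
last x []       = x
last x (y ∷ ys) = last y ys

-- A cycle: distinct vertices x₀,…,x_k with k ≥ 2, consecutive ones adjacent,
-- and x_k adjacent to x₀.
record Cycle {n} (G : Graph n) : Set where
  field
    x₀     : Fin n
    x₁     : Fin n
    x₂     : Fin n
    rest   : List (Fin n)
    distinct : Unique (x₀ ∷ x₁ ∷ x₂ ∷ rest)
    path   : Linked (Adj G) (x₀ ∷ x₁ ∷ x₂ ∷ rest)
    closes : Adj G (last x₂ rest) x₀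

Acyclic : ∀ {n} → Graph n → Set
Acyclic G = ¬ Cycle G

IsTree : ∀ {n} → Graph n → Set
IsTree G = Connected G × Acyclic G

BandwidthOfAtMost : ∀ {n} → Graph n → (Fin n → Fin n) → ℕ → Set
BandwidthOfAtMost G σ b = ∀ u v → Adj G u v → ∣ toℕ (σ u) - toℕ (σ v) ∣ ≤ b

BwAtMost : ∀ {n} → Graph n → ℕ → Set
BwAtMost {n} G b = Σ (Fin n → Fin n) λ σ → Bijective _≡_ _≡_ σ × BandwidthOfAtMost G σ b

-- Apex graph: vertex fzero is the new vertex w, vertex fsuc i is vertex i of T.
apexAdj : ∀ {n} → Graph n → Fin (suc n) → Fin (suc n) → Bool
apexAdj T fzero    fzero    = false
apexAdj T fzero    (fsuc j) = true
apexAdj T (fsuc i) fzero    = true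
apexAdj T (fsuc i) (fsuc j) = adj T i j

apexSym : ∀ {n} (T : Graph n) u v → apexAdj T u v ≡ apexAdj T v u
apexSym T fzero    fzero    = Relation.Binary.PropositionalEquality.refl
apexSym T fzero    (fsuc j) = Relation.Binary.PropositionalEquality.refl
apexSym T (fsuc i) fzero    = Relation.Binary.PropositionalEquality.refl
apexSym T (fsuc i) (fsuc j) = sym T i j

apexIrr : ∀ {n} (T : Graph n) u → apexAdj T u u ≡ false
apexIrr T fzero    = Relation.Binary.PropositionalEquality.refl
apexIrr T (fsuc i) = irrfl T i

apex : ∀ {n} → Graph n → Graph (suc n)
apex T = record { adj = apexAdj T ; sym = apexSym T ; irrfl = apexIrr T }

-- Circular drawings: a cyclic order given by a bijection π : V → positions Fin m
-- (positions read around the circle).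
_≠ᵇ_ : ∀ {m} → Fin m → Fin m → Bool
a ≠ᵇ b = not ⌊ a ≟ b ⌋

between : ∀ {m} → (Fin m → Fin m) → Fin m → Fin m → Fin m → Bool
between π a b x =
  ((toℕ (π a) <ᵇ toℕ (π x)) ∧ (toℕ (π x) <ᵇ toℕ (π b))) ∨
  ((toℕ (π b) <ᵇ toℕ (π x)) ∧ (toℕ (π x) <ᵇ toℕ (π a)))

crossesᵇ : ∀ {m} → (Fin m → Fin m) → Fin m → Fin m → Fin m → Fin m → Bool
crossesᵇ π a b c d =
  (a ≠ᵇ c) ∧ (a ≠ᵇ d) ∧ (b ≠ᵇ c) ∧ (b ≠ᵇ d) ∧ (between π a b c xor between π a b d)

edges : ∀ {m} → Graph m → List (Fin m × Fin m)
edges {m} G = filter (λ p → Data.Bool.T? (edgeᵇ p)) pairs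
  where
    pairs : List (Fin m × Fin m)
    pairs = concatMap (λ c → map (λ d → (c , d)) (allFin m)) (allFin m)
    edgeᵇ : Fin m × Fin m → Bool
    edgeᵇ (c , d) = (toℕ c <ᵇ toℕ d) ∧ adj G c d

crossingNumber : ∀ {m} → Graph m → (Fin m → Fin m) → Fin m → Fin m → ℕ
crossingNumber G π a b =
  length (filter (λ p → Data.Bool.T? (crossesᵇ π a b (Data.Product.proj₁ p) (Data.Product.proj₂ p))) (edges G))

OuterKPlanarDrawing : ∀ {m} → Graph m → ℕ → (Fin m → Fin m) → Set
OuterKPlanarDrawing G k π =
  Bijective _≡_ _≡_ π × (∀ a b → Adj G a b → crossingNumber G π a b ≤ k)

AdmitsOuterKPlanarDrawing : ∀ {m} → Graph m → ℕ → Set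
AdmitsOuterKPlanarDrawing {m} G k = ∃[ π ] OuterKPlanarDrawing G k π

-- Place the apex first and the vertices of T after it in a linear order σ of bandwidth b = r + 1.
-- A tree edge crossing the spoke to x has one end before x and one after it, so both ends lie
-- within distance r of x.  An edge crossing a tree edge pq (q at most b places after p) is either
-- a spoke to one of the at most r vertices strictly between p and q, or a tree edge with an end
-- strictly between them, whose ends then lie in a window of 3r + 2 positions and avoid q.
-- The tree edges among k vertices form a forest, so there are fewer than k of them: a nonempty
-- edge set of an acyclic graph has a leaf, since a walk that never turns back must close a cycle.
-- Hence a spoke is crossed at most 2r times, a tree edge at most r + 3r times, and 4r ≤ 5b - 5.

{-# OPTIONS --safe #-}
module Submission where

open import Defs hiding (sym)
open import Data.Bool using (T; T?; true; false; _∧_; _xor_)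
open import Data.Bool.Properties using (T-∧; T-∨; T-≡)
open import Data.Empty using (⊥-elim)
open import Data.Fin using (Fin; toℕ) renaming (zero to fzero; suc to fsuc)
open import Data.Fin.Properties using (_≟_; toℕ-injective; suc-injective; any?)
open import Data.List using (List; []; _∷_; _++_; length; filter; map; allFin; applyUpTo; concatMap; cartesianProduct)
open import Data.List.Properties using (length-++; length-++-sucʳ; length-map; length-applyUpTo; length-tabulate; filter-notAll)
open import Data.List.Membership.Propositional using (_∈_; lose)
open import Data.List.Membership.Propositional.Properties
  using (∈-∃++; ∈-++⁺ˡ; ∈-++⁺ʳ; ∈-++⁻; ∈-map⁺; ∈-map⁻; ∈-filter⁺; ∈-filter⁻; ∈-allFin; ∈-concat⁺′; ∈-applyUpTo⁺; ∈-length)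
import Data.List.Membership.DecPropositional as DecMembership
open import Data.List.Relation.Binary.Subset.Propositional using (_⊆_)
open import Data.List.Relation.Unary.All as All using ([]; _∷_)
import Data.List.Relation.Unary.All.Properties as All
open import Data.List.Relation.Unary.Any using (here; there)
open import Data.List.Relation.Unary.AllPairs using ([]; _∷_)
open import Data.List.Relation.Unary.Linked as Linked using (Linked; []; [-]; _∷_)
open import Data.List.Relation.Unary.Unique.Propositional using (Unique)
import Data.List.Relation.Unary.Unique.Propositional.Properties as Unique
open import Data.Nat using (ℕ; zero; suc; _<ᵇ_; _+_; _*_; _∸_; _≤_; _<_; _≤?_; _<?_; z≤n; s≤s; s≤s⁻¹; s<s⁻¹; z<s; s<s)
open import Data.Nat.Induction using (<-wellFounded)
open import Data.Nat.Properties hiding (_≟_; suc-injective)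
open import Data.Nat.Tactic.RingSolver using (solve-∀)
open import Data.Product using (∃₂; ∃-syntax; _×_; _,_; proj₁; proj₂)
import Data.Product as Product
open import Data.Product.Properties using (≡-dec)
open import Data.Sum using (_⊎_; inj₁; inj₂)
import Data.Sum as Sum
open import Function using (_∘_; id)
open import Function.Bundles using (module Equivalence)
open import Function.Definitions using (Injective; Surjective; Bijective)
open import Induction.WellFounded using (Acc; acc)
open import Relation.Binary.Definitions using (tri<; tri≈; tri>)
open import Relation.Binary.PropositionalEquality using (_≡_; _≢_; refl; sym; trans; cong; cong₂; subst)
open import Relation.Nullary using (¬_; Dec; yes; no; ¬?; contradiction)
open import Relation.Nullary.Decidable using (_×-dec_; _⊎-dec_; toWitnessFalse; decidable-stable)
open import Relation.Unary using (Decidable)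

-- Counting duplicate-free lists

Unique-⊆⇒length≤ : ∀ {A : Set} {xs ys : List A} → Unique xs → xs ⊆ ys → length xs ≤ length ys
Unique-⊆⇒length≤ {xs = []} _ _ = z≤n
Unique-⊆⇒length≤ {xs = x ∷ xs} (x∉xs ∷ xs!) xs⊆ys with ∈-∃++ (xs⊆ys (here refl))
... | ys₁ , ys₂ , refl = begin
  suc (length xs)           ≤⟨ s≤s (Unique-⊆⇒length≤ xs! xs⊆ys₁++ys₂) ⟩
  suc (length (ys₁ ++ ys₂)) ≡⟨ length-++-sucʳ ys₁ x ys₂ ⟨
  length (ys₁ ++ x ∷ ys₂)   ∎
  where
  open ≤-Reasoning
  xs⊆ys₁++ys₂ : xs ⊆ ys₁ ++ ys₂
  xs⊆ys₁++ys₂ z∈xs with ∈-++⁻ ys₁ (xs⊆ys (there z∈xs))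
  ... | inj₁ z∈ys₁         = ∈-++⁺ˡ z∈ys₁
  ... | inj₂ (here refl)   = contradiction refl (All.lookup x∉xs z∈xs)
  ... | inj₂ (there z∈ys₂) = ∈-++⁺ʳ ys₁ z∈ys₂

Unique⇒length≤ : ∀ {n} {vs : List (Fin n)} → Unique vs → length vs ≤ n
Unique⇒length≤ vs! = ≤-trans (Unique-⊆⇒length≤ vs! (λ {v} _ → ∈-allFin v)) (≤-reflexive (length-tabulate id))

Unique-++⁻ˡ : ∀ {A : Set} (xs : List A) {ys} → Unique (xs ++ ys) → Unique xs
Unique-++⁻ˡ []       _           = []
Unique-++⁻ˡ (x ∷ xs) (x∉ ∷ xs!) = All.++⁻ˡ xs x∉ ∷ Unique-++⁻ˡ xs xs!

Linked-++⁻ˡ : ∀ {A : Set} {R : A → A → Set} (xs : List A) {ys} → Linked R (xs ++ ys) → Linked R xs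
Linked-++⁻ˡ []           _           = []
Linked-++⁻ˡ (x ∷ [])     _           = [-]
Linked-++⁻ˡ (x ∷ y ∷ xs) (Rxy ∷ Rxs) = Rxy ∷ Linked-++⁻ˡ (y ∷ xs) Rxs

∈⇒prefix-ending-at : ∀ {A : Set} {y c : A} cs → y ∈ c ∷ cs → ∃₂ λ r s → cs ≡ r ++ s × last c r ≡ y
∈⇒prefix-ending-at cs (here refl) = [] , cs , refl , refl
∈⇒prefix-ending-at (c′ ∷ cs) (there y∈) with ∈⇒prefix-ending-at cs y∈
... | r , s , refl , last≡y = c′ ∷ r , s , refl , last≡y

∈-interval⁺ : ∀ {lo len y} → lo ≤ y → y < lo + len → y ∈ applyUpTo (lo +_) len
∈-interval⁺ {lo} {len} {y} lo≤y y<lo+len =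
  subst (_∈ applyUpTo (lo +_) len) (m+[n∸m]≡n lo≤y)
        (∈-applyUpTo⁺ (lo +_) (+-cancelˡ-< lo _ _ (subst (_< lo + len) (sym (m+[n∸m]≡n lo≤y)) y<lo+len)))

module _ {n : ℕ} (f : Fin n → ℕ) where

  InSlice : ℕ → ℕ → Fin n → Set
  InSlice lo len v = lo ≤ f v × f v < lo + len

  inSlice? : ∀ lo len → Decidable (InSlice lo len)
  inSlice? lo len v = (lo ≤? f v) ×-dec (f v <? lo + len)

  slice : ℕ → ℕ → List (Fin n)
  slice lo len = filter (inSlice? lo len) (allFin n)

  ∈-slice⁺ : ∀ {lo len v} → InSlice lo len v → v ∈ slice lo len
  ∈-slice⁺ {lo} {len} {v} = ∈-filter⁺ (inSlice? lo len) (∈-allFin v)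

  length-slice : Injective _≡_ _≡_ f → ∀ lo len → length (slice lo len) ≤ len
  length-slice f-injective lo len = begin
    length (slice lo len)          ≡⟨ length-map f (slice lo len) ⟨
    length (map f (slice lo len))  ≤⟨ Unique-⊆⇒length≤ image! image⊆ ⟩
    length (applyUpTo (lo +_) len) ≡⟨ length-applyUpTo (lo +_) len ⟩
    len                            ∎
    where
    open ≤-Reasoning
    image! : Unique (map f (slice lo len))
    image! = Unique.map⁺ f-injective (Unique.filter⁺ (inSlice? lo len) (Unique.allFin⁺ n))
    image⊆ : map f (slice lo len) ⊆ applyUpTo (lo +_) len
    image⊆ y∈ with ∈-map⁻ f y∈
    ... | v , v∈ , refl = Product.uncurry ∈-interval⁺ (proj₂ (∈-filter⁻ (inSlice? lo len) {xs = allFin n} v∈))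

-- Cycles and forests

module GraphProperties {n : ℕ} (G : Graph n) where

  open DecMembership (_≟_ {n}) using (_∈?_)

  Adj-sym : ∀ {u v} → Adj G u v → Adj G v u
  Adj-sym {u} {v} u~v = trans (Graph.sym G v u) u~v

  Adj⇒≢ : ∀ {u v} → Adj G u v → u ≢ v
  Adj⇒≢ {u} u~u refl = contradiction (trans (sym u~u) (irrfl G u)) λ ()

  chord⇒cycle : ∀ {a b y ps} → Unique (a ∷ b ∷ ps) → Linked (Adj G) (a ∷ b ∷ ps) →
                y ∈ ps → Adj G a y → Cycle G
  chord⇒cycle {a} {b} {ps = c ∷ cs} ps! walk y∈ps a~y with ∈⇒prefix-ending-at cs y∈ps
  ... | r , s , refl , last≡y = record
    { x₀ = a ; x₁ = b ; x₂ = c ; rest = r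
    ; distinct = Unique-++⁻ˡ (a ∷ b ∷ c ∷ r) ps!
    ; path     = Linked-++⁻ˡ (a ∷ b ∷ c ∷ r) walk
    ; closes   = subst (λ z → Adj G z a) (sym last≡y) (Adj-sym a~y)
    }

  -- The walk is kept a path, which cannot grow beyond n vertices.
  module _ (R : Fin n → Fin n → Set) (R⇒Adj : ∀ {u v} → R u v → Adj G u v)
           (R-sym : ∀ {u v} → R u v → R v u)
           (branching : ∀ {v a} → R v a → ∀ u → ∃[ y ] R v y × y ≢ u) where

    private
      extend : ∀ k {a b ps} → Unique (a ∷ b ∷ ps) → Linked R (a ∷ b ∷ ps) → n ≤ k + length ps → Cycle G
      extend k {a} {b} {ps} path! walk n≤ with branching (Linked.head walk) b
      ... | y , a~y , y≢b with y ∈? a ∷ b ∷ ps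
      ...   | yes (here refl)          = contradiction refl (Adj⇒≢ (R⇒Adj a~y))
      ...   | yes (there (here refl))  = contradiction refl y≢b
      ...   | yes (there (there y∈ps)) = chord⇒cycle path! (Linked.map R⇒Adj walk) y∈ps (R⇒Adj a~y)
      ...   | no y∉path with k
      ...     | zero  = contradiction (≤-trans (n≤1+n _) (≤-trans (Unique⇒length≤ path!) n≤)) 1+n≰n
      ...     | suc k = extend k (All.¬Any⇒All¬ _ y∉path ∷ path!) (R-sym a~y ∷ walk)
                          (subst (n ≤_) (sym (+-suc k (length ps))) n≤)

    leafless⇒cycle : ∀ {a b} → R a b → Cycle G
    leafless⇒cycle a~b = extend n ((Adj⇒≢ (R⇒Adj a~b) ∷ []) ∷ [] ∷ []) (a~b ∷ [-]) (≤-reflexive (sym (+-identityʳ n)))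

Edge : ℕ → Set
Edge n = Fin n × Fin n

IsEdgeList : ∀ {n} → Graph n → List (Edge n) → Set
IsEdgeList G es = ∀ {c d} → (c , d) ∈ es → toℕ c < toℕ d × Adj G c d

module _ {n : ℕ} where

  open DecMembership (≡-dec (_≟_ {n}) (_≟_ {n})) using (_∈?_)

  Joins : List (Edge n) → Fin n → Fin n → Set
  Joins es u v = (u , v) ∈ es ⊎ (v , u) ∈ es

  Incident : Fin n → Edge n → Set
  Incident v (c , d) = c ≡ v ⊎ d ≡ v

  Branching : List (Edge n) → Fin n → Fin n → Set
  Branching es v u = ∃[ y ] Joins es v y × y ≢ u

  Leaf : List (Edge n) → Fin n → Fin n → Set
  Leaf es v h = Joins es v h × ¬ Branching es v h

  joins? : ∀ es u v → Dec (Joins es u v)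
  joins? es u v = ((u , v) ∈? es) ⊎-dec ((v , u) ∈? es)

  incident? : ∀ v → Decidable (Incident v)
  incident? v (c , d) = (c ≟ v) ⊎-dec (d ≟ v)

  branching? : ∀ es v u → Dec (Branching es v u)
  branching? es v u = any? (λ y → joins? es v y ×-dec ¬? (y ≟ u))

  lone-neighbour : ∀ {es v u a} → ¬ Branching es v u → Joins es v a → a ≡ u
  lone-neighbour {u = u} {a} ¬br v~a = decidable-stable (a ≟ u) (λ a≢u → ¬br (a , v~a , a≢u))

  Joins⇒incident-edge : ∀ {es v u} → Joins es v u → ∃[ e ] e ∈ es × Incident v e
  Joins⇒incident-edge (inj₁ vu∈) = _ , vu∈ , inj₁ refl
  Joins⇒incident-edge (inj₂ uv∈) = _ , uv∈ , inj₂ refl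

module _ {n : ℕ} {G : Graph n} {es : List (Edge n)} (es-edges : IsEdgeList G es) where

  open GraphProperties G

  Joins⇒Adj : ∀ {u v} → Joins es u v → Adj G u v
  Joins⇒Adj (inj₁ uv∈) = proj₂ (es-edges uv∈)
  Joins⇒Adj (inj₂ vu∈) = Adj-sym (proj₂ (es-edges vu∈))

  incident-edge-form : ∀ {v h c d} → ¬ Branching es v h → (c , d) ∈ es → Incident v (c , d) →
                       (c , d) ≡ (v , h) ⊎ (c , d) ≡ (h , v)
  incident-edge-form ¬br cd∈ (inj₁ refl) = inj₁ (cong (_ ,_) (lone-neighbour ¬br (inj₁ cd∈)))
  incident-edge-form ¬br cd∈ (inj₂ refl) = inj₂ (cong (_, _) (lone-neighbour ¬br (inj₂ cd∈)))

  leaf-edge-unique : ∀ {v h e e′} → ¬ Branching es v h → e ∈ es → e′ ∈ es →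
                     Incident v e → Incident v e′ → e ≡ e′
  leaf-edge-unique {e = _ , _} {_ , _} ¬br e∈ e′∈ inc inc′
    with incident-edge-form ¬br e∈ inc | incident-edge-form ¬br e′∈ inc′
  ... | inj₁ refl | inj₁ refl = refl
  ... | inj₂ refl | inj₂ refl = refl
  ... | inj₁ refl | inj₂ refl = ⊥-elim (<-asym (proj₁ (es-edges e∈)) (proj₁ (es-edges e′∈)))
  ... | inj₂ refl | inj₁ refl = ⊥-elim (<-asym (proj₁ (es-edges e∈)) (proj₁ (es-edges e′∈)))

  leaf-exists : Acyclic G → ∀ {e} → e ∈ es → ∃₂ (Leaf es)
  leaf-exists acyclic e∈ with any? (λ v → any? (λ h → joins? es v h ×-dec ¬? (branching? es v h)))
  ... | yes (v , h , leaf) = v , h , leaf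
  ... | no no-leaf = contradiction (leafless⇒cycle (Joins es) Joins⇒Adj Sum.swap branches (inj₁ e∈)) acyclic
    where
    branches : ∀ {v a} → Joins es v a → ∀ u → Branching es v u
    branches {v} v~a u with branching? es v u
    ... | yes br  = br
    ... | no ¬br = contradiction (v , u , subst (Joins es v) (lone-neighbour ¬br v~a) v~a , ¬br) no-leaf

  module LeafRemoval (es! : Unique es) {S : List (Fin n)} (es⊆S : ∀ {c d} → (c , d) ∈ es → c ∈ S × d ∈ S)
                     {v h} (leaf : Leaf es v h) where

    es∖v : List (Edge n)
    es∖v = filter (¬? ∘ incident? v) es

    S∖v : List (Fin n)
    S∖v = filter (¬? ∘ (_≟ v)) S

    private
      e₀ : Edge n
      e₀ = proj₁ (Joins⇒incident-edge (proj₁ leaf))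

      e₀∈es : e₀ ∈ es
      e₀∈es = proj₁ (proj₂ (Joins⇒incident-edge (proj₁ leaf)))

      e₀-incident : Incident v e₀
      e₀-incident = proj₂ (proj₂ (Joins⇒incident-edge (proj₁ leaf)))

      Joins⇒∈S : ∀ {x y} → Joins es x y → y ∈ S
      Joins⇒∈S (inj₁ xy∈) = proj₂ (es⊆S xy∈)
      Joins⇒∈S (inj₂ yx∈) = proj₁ (es⊆S yx∈)

      es⊆e₀∷es∖v : es ⊆ e₀ ∷ es∖v
      es⊆e₀∷es∖v {e} e∈ with incident? v e
      ... | yes inc  = here (leaf-edge-unique (proj₂ leaf) e∈ e₀∈es inc e₀-incident)
      ... | no ¬inc = there (∈-filter⁺ (¬? ∘ incident? v) e∈ ¬inc)

    length-es≤ : length es ≤ suc (length es∖v)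
    length-es≤ = Unique-⊆⇒length≤ es! es⊆e₀∷es∖v

    es∖v<es : length es∖v < length es
    es∖v<es = filter-notAll (¬? ∘ incident? v) es (lose e₀∈es (λ ¬inc → ¬inc e₀-incident))

    S∖v<S : length S∖v < length S
    S∖v<S = filter-notAll (¬? ∘ (_≟ v)) S (lose (Joins⇒∈S (Sum.swap (proj₁ leaf))) (λ v≢v → v≢v refl))

    h∈S∖v : h ∈ S∖v
    h∈S∖v = ∈-filter⁺ (¬? ∘ (_≟ v)) (Joins⇒∈S (proj₁ leaf)) (Adj⇒≢ (Joins⇒Adj (proj₁ leaf)) ∘ sym)

    es∖v! : Unique es∖v
    es∖v! = Unique.filter⁺ (¬? ∘ incident? v) es!

    es∖v-edges : IsEdgeList G es∖v
    es∖v-edges e∈ = es-edges (proj₁ (∈-filter⁻ (¬? ∘ incident? v) {xs = es} e∈))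

    es∖v⊆S∖v : ∀ {c d} → (c , d) ∈ es∖v → c ∈ S∖v × d ∈ S∖v
    es∖v⊆S∖v cd∈ with ∈-filter⁻ (¬? ∘ incident? v) {xs = es} cd∈
    ... | cd∈es , ¬inc = ∈-filter⁺ (¬? ∘ (_≟ v)) (proj₁ (es⊆S cd∈es)) (¬inc ∘ inj₁)
                       , ∈-filter⁺ (¬? ∘ (_≟ v)) (proj₂ (es⊆S cd∈es)) (¬inc ∘ inj₂)

edges<vertices : ∀ {n} {G : Graph n} → Acyclic G → ∀ {es S w} → Unique es → IsEdgeList G es →
                 (∀ {c d} → (c , d) ∈ es → c ∈ S × d ∈ S) → w ∈ S → length es < length S
edges<vertices {n} {G} acyclic {es} = go (<-wellFounded (length es))
  where
  go : ∀ {es : List (Edge n)} {S w} → Acc _<_ (length es) → Unique es → IsEdgeList G es →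
       (∀ {c d} → (c , d) ∈ es → c ∈ S × d ∈ S) → w ∈ S → length es < length S
  go {[]}         _         _   _        _    w∈S = ∈-length w∈S
  go {es@(_ ∷ _)} {S} (acc rec) es! es-edges es⊆S _ with leaf-exists es-edges acyclic (here refl)
  ... | v , h , leaf = begin-strict
    length es         ≤⟨ length-es≤ ⟩
    suc (length es∖v) ≤⟨ go (rec es∖v<es) es∖v! es∖v-edges es∖v⊆S∖v h∈S∖v ⟩
    length S∖v        <⟨ S∖v<S ⟩
    length S          ∎
    where
    open LeafRemoval {G = G} es-edges es! es⊆S leaf
    open ≤-Reasoning

-- Crossings in circular drawings

module _ {m : ℕ} (G : Graph m) where

  private
    concatMap≡cartesianProduct : ∀ {A B : Set} (xs : List A) (ys : List B) →
                                 concatMap (λ c → map (c ,_) ys) xs ≡ cartesianProduct xs ys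
    concatMap≡cartesianProduct []       ys = refl
    concatMap≡cartesianProduct (x ∷ xs) ys = cong (map (x ,_) ys ++_) (concatMap≡cartesianProduct xs ys)

  edges-unique : Unique (edges G)
  edges-unique = Unique.filter⁺ _ (subst Unique (sym (concatMap≡cartesianProduct (allFin m) (allFin m)))
                                    (Unique.cartesianProduct⁺ (Unique.allFin⁺ m) (Unique.allFin⁺ m)))

  edges-isEdgeList : IsEdgeList G (edges G)
  edges-isEdgeList {c} {d} cd∈ with Equivalence.to T-∧ (proj₂ (∈-filter⁻ _ {xs = concatMap (λ c → map (c ,_) (allFin m)) (allFin m)} cd∈))
  ... | c<d , c~d = <ᵇ⇒< (toℕ c) (toℕ d) c<d , Equivalence.to T-≡ c~d

  ∈-edges⁺ : ∀ {c d} → toℕ c < toℕ d → Adj G c d → (c , d) ∈ edges G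
  ∈-edges⁺ {c} {d} c<d c~d =
    ∈-filter⁺ _ (∈-concat⁺′ (∈-map⁺ (c ,_) (∈-allFin d)) (∈-map⁺ (λ c → map (c ,_) (allFin m)) (∈-allFin c)))
                (Equivalence.from T-∧ (<⇒<ᵇ c<d , Equivalence.from T-≡ c~d))

Between : ℕ → ℕ → ℕ → Set
Between p q x = (p < x × x < q) ⊎ (q < x × x < p)

T-xor : ∀ x y → T (x xor y) → (T x × ¬ T y) ⊎ (¬ T x × T y)
T-xor true  false _ = inj₁ (_ , λ ())
T-xor false true  _ = inj₂ ((λ ()) , _)

module _ {m : ℕ} (π : Fin m → Fin m) where

  Inside : Fin m → Fin m → Fin m → Set
  Inside a b z = Between (toℕ (π a)) (toℕ (π b)) (toℕ (π z))

  record Crossing (a b c d : Fin m) : Set where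
    field
      a≢c : a ≢ c
      a≢d : a ≢ d
      b≢c : b ≢ c
      b≢d : b ≢ d
      separated : (Inside a b c × ¬ Inside a b d) ⊎ (¬ Inside a b c × Inside a b d)

  private
    between⇒Inside : ∀ {a b z} → T (between π a b z) → Inside a b z
    between⇒Inside t = Sum.map <ᵇ-pair⇒ <ᵇ-pair⇒ (Equivalence.to T-∨ t)
      where
      <ᵇ-pair⇒ : ∀ {x y z} → T ((x <ᵇ y) ∧ (y <ᵇ z)) → x < y × y < z
      <ᵇ-pair⇒ t = Product.map (<ᵇ⇒< _ _) (<ᵇ⇒< _ _) (Equivalence.to T-∧ t)

    Inside⇒between : ∀ {a b z} → Inside a b z → T (between π a b z)
    Inside⇒between i = Equivalence.from T-∨ (Sum.map ⇒<ᵇ-pair ⇒<ᵇ-pair i)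
      where
      ⇒<ᵇ-pair : ∀ {x y z} → x < y × y < z → T ((x <ᵇ y) ∧ (y <ᵇ z))
      ⇒<ᵇ-pair (x<y , y<z) = Equivalence.from T-∧ (<⇒<ᵇ x<y , <⇒<ᵇ y<z)

  crossesᵇ⇒Crossing : ∀ {a b c d} → T (crossesᵇ π a b c d) → Crossing a b c d
  crossesᵇ⇒Crossing {a} {b} {c} {d} t
    with a≠c , t₁ ← Equivalence.to T-∧ t
    with a≠d , t₂ ← Equivalence.to T-∧ t₁
    with b≠c , t₃ ← Equivalence.to T-∧ t₂
    with b≠d , t₄ ← Equivalence.to T-∧ t₃ = record
      { a≢c = toWitnessFalse {a? = a ≟ c} a≠c
      ; a≢d = toWitnessFalse {a? = a ≟ d} a≠d
      ; b≢c = toWitnessFalse {a? = b ≟ c} b≠c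
      ; b≢d = toWitnessFalse {a? = b ≟ d} b≠d
      ; separated = Sum.map (Product.map between⇒Inside (_∘ Inside⇒between))
                            (Product.map (_∘ Inside⇒between) between⇒Inside)
                            (T-xor _ _ t₄)
      }

  Crossing-swap : ∀ {a b c d} → Crossing a b c d → Crossing b a c d
  Crossing-swap x = record
    { a≢c = b≢c ; a≢d = b≢d ; b≢c = a≢c ; b≢d = a≢d
    ; separated = Sum.map (Product.map Sum.swap (_∘ Sum.swap)) (Product.map (_∘ Sum.swap) Sum.swap) separated
    }
    where open Crossing x

record CrossingEdges {m} (G : Graph m) (π : Fin m → Fin m) (a b : Fin m) (L : List (Edge m)) : Set where
  field
    unique   : Unique L
    ⊆edges   : L ⊆ edges G
    crossing : ∀ {c d} → (c , d) ∈ L → Crossing π a b c d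

module _ {m : ℕ} {G : Graph m} {π : Fin m → Fin m} where

  crossings : Fin m → Fin m → List (Edge m)
  crossings a b = filter (λ p → T? (crossesᵇ π a b (proj₁ p) (proj₂ p))) (edges G)

  crossings-CrossingEdges : ∀ a b → CrossingEdges G π a b (crossings a b)
  crossings-CrossingEdges a b = record
    { unique   = Unique.filter⁺ _ (edges-unique G)
    ; ⊆edges   = proj₁ ∘ ∈-filter⁻ _ {xs = edges G}
    ; crossing = crossesᵇ⇒Crossing π ∘ proj₂ ∘ ∈-filter⁻ _ {xs = edges G}
    }

  CrossingEdges-swap : ∀ {a b L} → CrossingEdges G π a b L → CrossingEdges G π b a L
  CrossingEdges-swap X = record { unique = unique ; ⊆edges = ⊆edges ; crossing = Crossing-swap π ∘ crossing }
    where open CrossingEdges X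

-- The apex drawing

module _ {n : ℕ} {T : Graph n} (acyclic : Acyclic T) where

  open DecMembership (≡-dec (_≟_ {suc n}) (_≟_ {suc n})) using (_∈?_)

  apex-edgeSet-bound : ∀ {L} → Unique L → L ⊆ edges (apex T) → (A S : List (Fin n)) →
                       (∀ {y} → (fzero , fsuc y) ∈ L → y ∈ A) →
                       (∀ {c d} → (fsuc c , fsuc d) ∈ L → c ∈ S × d ∈ S) →
                       ∀ {w} → w ∈ S → length L < length A + length S
  apex-edgeSet-bound {L} L! L⊆edges A S spokes⊆A tree⊆S w∈S = begin-strict
    length L                                    ≤⟨ Unique-⊆⇒length≤ L! L⊆split ⟩
    length (map spoke A ++ map lift L′)         ≡⟨ length-++ (map spoke A) ⟩
    length (map spoke A) + length (map lift L′) ≡⟨ cong₂ _+_ (length-map spoke A) (length-map lift L′) ⟩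
    length A + length L′                        <⟨ +-monoʳ-< (length A) (edges<vertices acyclic L′! L′-edges L′⊆S w∈S) ⟩
    length A + length S                         ∎
    where
    open ≤-Reasoning
    spoke : Fin n → Edge (suc n)
    spoke y = fzero , fsuc y
    lift : Edge n → Edge (suc n)
    lift (c , d) = fsuc c , fsuc d
    lifted? : Decidable (λ e → lift e ∈ L)
    lifted? e = lift e ∈? L
    L′ : List (Edge n)
    L′ = filter lifted? (edges T)
    L′! : Unique L′
    L′! = Unique.filter⁺ lifted? (edges-unique T)
    L′-edges : IsEdgeList T L′
    L′-edges cd∈ = edges-isEdgeList T (proj₁ (∈-filter⁻ lifted? {xs = edges T} cd∈))
    L′⊆S : ∀ {c d} → (c , d) ∈ L′ → c ∈ S × d ∈ S
    L′⊆S cd∈ = tree⊆S (proj₂ (∈-filter⁻ lifted? {xs = edges T} cd∈))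
    L⊆split : L ⊆ map spoke A ++ map lift L′
    L⊆split {fzero , fzero} e∈ = contradiction (proj₂ (edges-isEdgeList (apex T) (L⊆edges e∈))) λ ()
    L⊆split {fzero , fsuc y} e∈ = ∈-++⁺ˡ (∈-map⁺ spoke (spokes⊆A e∈))
    L⊆split {fsuc c , fzero} e∈ = contradiction (proj₁ (edges-isEdgeList (apex T) (L⊆edges e∈))) λ ()
    L⊆split {fsuc c , fsuc d} e∈ with edges-isEdgeList (apex T) (L⊆edges e∈)
    ... | c<d , c~d = ∈-++⁺ʳ (map spoke A) (∈-map⁺ lift (∈-filter⁺ lifted? (∈-edges⁺ T (s<s⁻¹ c<d) c~d) e∈))

module ApexDrawing {n : ℕ} (σ : Fin n → Fin n) (σ-bijective : Bijective _≡_ _≡_ σ) where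

  pos : Fin n → ℕ
  pos v = toℕ (σ v)

  pos-injective : Injective _≡_ _≡_ pos
  pos-injective = proj₁ σ-bijective ∘ toℕ-injective

  drawing : Fin (suc n) → Fin (suc n)
  drawing fzero    = fzero
  drawing (fsuc v) = fsuc (σ v)

  drawing-bijective : Bijective _≡_ _≡_ drawing
  drawing-bijective = injective , surjective
    where
    injective : Injective _≡_ _≡_ drawing
    injective {fzero}  {fzero}  _  = refl
    injective {fsuc u} {fsuc v} eq = cong fsuc (proj₁ σ-bijective (suc-injective eq))
    surjective : Surjective _≡_ _≡_ drawing
    surjective fzero    = fzero , λ { refl → refl }
    surjective (fsuc y) with proj₂ σ-bijective y
    ... | x , σx≡y = fsuc x , λ { refl → cong fsuc (σx≡y refl) }

  apex-not-Inside : ∀ {a b} → ¬ Inside drawing a b fzero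
  apex-not-Inside (inj₁ (() , _))
  apex-not-Inside (inj₂ (() , _))

  Inside-spoke⁺ : ∀ {x u} → pos u < pos x → Inside drawing fzero (fsuc x) (fsuc u)
  Inside-spoke⁺ u<x = inj₁ (z<s , s<s u<x)

  Inside-spoke⁻ : ∀ {x u} → Inside drawing fzero (fsuc x) (fsuc u) → pos u < pos x
  Inside-spoke⁻ (inj₁ (_ , u<x)) = s<s⁻¹ u<x

  Inside-tree⁻ : ∀ {p q u} → pos p < pos q → Inside drawing (fsuc p) (fsuc q) (fsuc u) → pos p < pos u × pos u < pos q
  Inside-tree⁻ _   (inj₁ (p<u , u<q)) = s<s⁻¹ p<u , s<s⁻¹ u<q
  Inside-tree⁻ p<q (inj₂ (q<u , u<p)) = ⊥-elim (<-asym p<q (<-trans (s<s⁻¹ q<u) (s<s⁻¹ u<p)))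

  Outside-spoke⁻ : ∀ {x u} → ¬ Inside drawing fzero (fsuc x) (fsuc u) → fsuc x ≢ fsuc u → pos x < pos u
  Outside-spoke⁻ out x≢u = ≤∧≢⇒< (≮⇒≥ (out ∘ Inside-spoke⁺)) (x≢u ∘ cong fsuc ∘ pos-injective)

  spoke-crossing : ∀ {x c d} → Crossing drawing fzero (fsuc x) (fsuc c) (fsuc d) → Between (pos c) (pos d) (pos x)
  spoke-crossing cr with Crossing.separated cr
  ... | inj₁ (c-in , d-out) = inj₁ (Inside-spoke⁻ c-in , Outside-spoke⁻ d-out (Crossing.b≢d cr))
  ... | inj₂ (c-out , d-in) = inj₂ (Inside-spoke⁻ d-in , Outside-spoke⁻ c-out (Crossing.b≢c cr))

  tree-crossing-spoke : ∀ {p q y} → pos p < pos q → Crossing drawing (fsuc p) (fsuc q) fzero (fsuc y) →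
                        pos p < pos y × pos y < pos q
  tree-crossing-spoke p<q cr with Crossing.separated cr
  ... | inj₁ (apex-in , _) = ⊥-elim (apex-not-Inside apex-in)
  ... | inj₂ (_ , y-in)    = Inside-tree⁻ p<q y-in

  tree-crossing-tree : ∀ {p q c d} → pos p < pos q → Crossing drawing (fsuc p) (fsuc q) (fsuc c) (fsuc d) →
                       (pos p < pos c × pos c < pos q) ⊎ (pos p < pos d × pos d < pos q)
  tree-crossing-tree p<q cr = Sum.map (Inside-tree⁻ p<q ∘ proj₁) (Inside-tree⁻ p<q ∘ proj₂) (Crossing.separated cr)

  module _ {T : Graph n} (acyclic : Acyclic T) (r : ℕ) (bw : BandwidthOfAtMost T σ (suc r)) where

    open GraphProperties T

    stretch : ∀ {u z} → Adj T u z → pos z ≤ pos u + suc r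
    stretch {u} {z} u~z = ≤-trans (m≤n+∣m-n∣ (pos z) (pos u)) (+-monoʳ-≤ (pos u) (bw z u (Adj-sym u~z)))

    reach-below : ∀ {lo u z} → lo < pos u → Adj T u z → lo ≤ pos z + r
    reach-below {lo} {u} {z} lo<u u~z = s≤s⁻¹ (begin
      suc lo        ≤⟨ lo<u ⟩
      pos u         ≤⟨ stretch (Adj-sym u~z) ⟩
      pos z + suc r ≡⟨ +-suc (pos z) r ⟩
      suc (pos z + r) ∎)
      where open ≤-Reasoning

    reach-above : ∀ {hi u z} → pos u < hi → Adj T u z → pos z ≤ hi + r
    reach-above {hi} {u} {z} u<hi u~z = begin
      pos z         ≤⟨ stretch u~z ⟩
      pos u + suc r ≡⟨ +-suc (pos u) r ⟩
      suc (pos u) + r ≤⟨ +-monoˡ-≤ r u<hi ⟩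
      hi + r        ∎
      where open ≤-Reasoning

    private
      2r≤4r : 2 * r ≤ 4 * r
      2r≤4r = *-monoˡ-≤ r {2} {4} (s≤s (s≤s z≤n))

    -- The vertices at positions in [lo - r, lo + ℓ + r], shifted by r to avoid truncated subtraction.
    window : ℕ → ℕ → List (Fin n)
    window lo ℓ = slice (λ v → pos v + r) lo (suc (ℓ + 2 * r))

    length-window : ∀ lo ℓ → length (window lo ℓ) ≤ suc (ℓ + 2 * r)
    length-window lo ℓ = length-slice (λ v → pos v + r) (pos-injective ∘ +-cancelʳ-≡ r _ _) lo (suc (ℓ + 2 * r))

    ∈-window⁺ : ∀ {lo hi ℓ v} → hi ≤ lo + ℓ → lo ≤ pos v + r → pos v ≤ hi + r → v ∈ window lo ℓ
    ∈-window⁺ {lo} {hi} {ℓ} {v} hi≤ lo≤ ≤hi = ∈-slice⁺ _ (lo≤ , (begin-strict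
      pos v + r          ≤⟨ +-monoˡ-≤ r (≤-trans ≤hi (+-monoˡ-≤ r hi≤)) ⟩
      lo + ℓ + r + r     ≡⟨ shift lo ℓ r ⟩
      lo + (ℓ + 2 * r)   <⟨ +-monoʳ-< lo (n<1+n _) ⟩
      lo + suc (ℓ + 2 * r) ∎))
      where
      open ≤-Reasoning
      shift : ∀ lo ℓ r → lo + ℓ + r + r ≡ lo + (ℓ + 2 * r)
      shift = solve-∀

    edge⊆window : ∀ {lo hi ℓ u z} → hi ≤ lo + ℓ → Adj T u z →
                  lo < pos u ⊎ lo < pos z → pos u < hi ⊎ pos z < hi → u ∈ window lo ℓ × z ∈ window lo ℓ
    edge⊆window {lo} {hi} {ℓ} hi≤ u~z reaches-lo reaches-hi =
      endpoint∈window (Adj-sym u~z) (Sum.swap reaches-lo) (Sum.swap reaches-hi) ,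
      endpoint∈window u~z reaches-lo reaches-hi
      where
      endpoint∈window : ∀ {u z} → Adj T u z → lo < pos u ⊎ lo < pos z → pos u < hi ⊎ pos z < hi → z ∈ window lo ℓ
      endpoint∈window u~z reaches-lo reaches-hi = ∈-window⁺ hi≤
        (Sum.[ (λ lo<u → reach-below lo<u u~z) , (λ lo<z → m≤n⇒m≤n+o r (<⇒≤ lo<z)) ] reaches-lo)
        (Sum.[ (λ u<hi → reach-above u<hi u~z) , (λ z<hi → m≤n⇒m≤n+o r (<⇒≤ z<hi)) ] reaches-hi)

    spoke-bound : ∀ {x L} → CrossingEdges (apex T) drawing fzero (fsuc x) L → length L ≤ 2 * r
    spoke-bound {x} {L} X = s≤s⁻¹ (begin-strict
      length L    <⟨ apex-edgeSet-bound acyclic unique ⊆edges [] W no-spoke tree-edges⊆W x∈W ⟩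
      length W    ≤⟨ length-window (pos x) 0 ⟩
      suc (2 * r) ∎)
      where
      open ≤-Reasoning
      open CrossingEdges X
      W = window (pos x) 0
      x≤x+0 : pos x ≤ pos x + 0
      x≤x+0 = m≤m+n (pos x) 0
      x∈W : x ∈ W
      x∈W = ∈-window⁺ x≤x+0 (m≤m+n (pos x) r) (m≤m+n (pos x) r)
      no-spoke : ∀ {y} → (fzero , fsuc y) ∈ L → y ∈ []
      no-spoke e∈ = contradiction refl (Crossing.a≢c (crossing e∈))
      tree-edges⊆W : ∀ {c d} → (fsuc c , fsuc d) ∈ L → c ∈ W × d ∈ W
      tree-edges⊆W e∈ with c~d ← proj₂ (edges-isEdgeList (apex T) (⊆edges e∈)) | spoke-crossing (crossing e∈)
      ... | inj₁ (c<x , x<d) = edge⊆window x≤x+0 c~d (inj₂ x<d) (inj₁ c<x)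
      ... | inj₂ (d<x , x<c) = edge⊆window x≤x+0 c~d (inj₁ x<c) (inj₂ d<x)

    tree-edge-bound : ∀ {p q L} → Adj T p q → pos p < pos q →
                      CrossingEdges (apex T) drawing (fsuc p) (fsuc q) L → length L ≤ 4 * r
    tree-edge-bound {p} {q} {L} p~q p<q X = s≤s⁻¹ (begin-strict
      length L            <⟨ apex-edgeSet-bound acyclic unique ⊆edges A S spokes⊆A tree-edges⊆S p∈S ⟩
      length A + length S ≤⟨ +-mono-≤ (length-slice pos pos-injective (suc P) r) length-S ⟩
      r + (suc r + 2 * r) ≡⟨ tally r ⟩
      suc (4 * r)         ∎)
      where
      open ≤-Reasoning
      open CrossingEdges X
      tally : ∀ r → r + (suc r + 2 * r) ≡ suc (4 * r)
      tally = solve-∀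
      P = pos p
      Q = pos q
      Q≤P+b : Q ≤ P + suc r
      Q≤P+b = stretch p~q
      A = slice pos (suc P) r
      W = window P (suc r)
      ≢q? : Decidable (_≢ q)
      ≢q? v = ¬? (v ≟ q)
      -- No crossing edge touches q; without this saving the bound would fail for b = 1.
      S = filter ≢q? W
      length-S : length S ≤ suc r + 2 * r
      length-S = s≤s⁻¹ (≤-trans (filter-notAll ≢q? W (lose q∈W (λ q≢q → q≢q refl))) (length-window P (suc r)))
        where q∈W = ∈-window⁺ Q≤P+b (m≤n⇒m≤n+o r (<⇒≤ p<q)) (m≤m+n Q r)
      p∈S : p ∈ S
      p∈S = ∈-filter⁺ ≢q? (∈-window⁺ Q≤P+b (m≤m+n P r) (m≤n⇒m≤n+o r (<⇒≤ p<q)))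
                          (λ p≡q → <-irrefl (cong pos p≡q) p<q)
      spokes⊆A : ∀ {y} → (fzero , fsuc y) ∈ L → y ∈ A
      spokes⊆A e∈ with p<y , y<q ← tree-crossing-spoke p<q (crossing e∈) =
        ∈-slice⁺ pos (p<y , ≤-trans y<q (≤-trans Q≤P+b (≤-reflexive (+-suc P r))))
      tree-edges⊆S : ∀ {c d} → (fsuc c , fsuc d) ∈ L → c ∈ S × d ∈ S
      tree-edges⊆S {c} {d} e∈ = ∈-filter⁺ ≢q? (proj₁ in-W) c≢q , ∈-filter⁺ ≢q? (proj₂ in-W) d≢q
        where
        cr = crossing e∈
        c≢q : c ≢ q
        c≢q c≡q = Crossing.b≢c cr (cong fsuc (sym c≡q))
        d≢q : d ≢ q
        d≢q d≡q = Crossing.b≢d cr (cong fsuc (sym d≡q))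
        in-W : c ∈ W × d ∈ W
        in-W with c~d ← proj₂ (edges-isEdgeList (apex T) (⊆edges e∈)) | tree-crossing-tree p<q cr
        ... | inj₁ (p<c , c<q) = edge⊆window Q≤P+b c~d (inj₁ p<c) (inj₁ c<q)
        ... | inj₂ (p<d , d<q) = edge⊆window Q≤P+b c~d (inj₂ p<d) (inj₂ d<q)

    crossingNumber-bound : ∀ a b → Adj (apex T) a b → crossingNumber (apex T) drawing a b ≤ 4 * r
    crossingNumber-bound fzero    (fsuc x) _ =
      ≤-trans (spoke-bound (crossings-CrossingEdges fzero (fsuc x))) 2r≤4r
    crossingNumber-bound (fsuc x) fzero    _ =
      ≤-trans (spoke-bound (CrossingEdges-swap (crossings-CrossingEdges (fsuc x) fzero))) 2r≤4r
    crossingNumber-bound (fsuc p) (fsuc q) p~q with <-cmp (pos p) (pos q)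
    ... | tri< p<q _ _ = tree-edge-bound p~q p<q (crossings-CrossingEdges (fsuc p) (fsuc q))
    ... | tri≈ _ p≡q _ = contradiction (pos-injective p≡q) (Adj⇒≢ p~q)
    ... | tri> _ _ q<p = tree-edge-bound (Adj-sym p~q) q<p (CrossingEdges-swap (crossings-CrossingEdges (fsuc p) (fsuc q)))

4r≤5[1+r]∸5 : ∀ r → 4 * r ≤ 5 * suc r ∸ 5
4r≤5[1+r]∸5 r = begin
  4 * r           ≤⟨ *-monoˡ-≤ r {4} {5} (n≤1+n 4) ⟩
  5 * r           ≡⟨ m+n∸m≡n 5 (5 * r) ⟨
  5 + 5 * r ∸ 5   ≡⟨ cong (_∸ 5) (*-suc 5 r) ⟨
  5 * suc r ∸ 5   ∎
  where open ≤-Reasoning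

lemma18 : (b : ℕ) → 1 ≤ b → (n : ℕ) → (T : Graph n) → IsTree T →
    BwAtMost T b → AdmitsOuterKPlanarDrawing (apex T) (5 * b ∸ 5)
lemma18 (suc r) _ n T (_ , acyclic) (σ , σ-bijective , bw) =
  drawing , drawing-bijective ,
  λ a b a~b → ≤-trans (crossingNumber-bound acyclic r bw a b a~b) (4r≤5[1+r]∸5 r)
  where open ApexDrawing σ σ-bijective
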